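{- Let $A$ be a non-empty set of atoms. For all closed terms $P,Q\in\mathcal S_A$: $\mathrm{EqFSCL}\vdash P=Q$ if and only if $\mathbb M_{se}\models P=Q$ (equivalently, if and only if $se(P)=se(Q)$).
   Context: The signature $\Sigma_{\mathrm{SCL}}(A)$ consists of constants $\mathsf T,\mathsf F$ and $a$ for each $a\in A$, a unary connective $\neg$, and two binary connectives $\wedge$ and $\vee$ (left-sequential, short-circuit conjunction and disjunction). $\mathcal S_A$ is the set of closed terms over this signature. $\mathrm{EqFSCL}\vdash s=t$ means that $s=t$ is derivable in equational logic from the axioms: (F1) $\mathsf F=\neg\mathsf T$; (F2) $x\vee y=\neg(\neg x\wedge\neg y)$; (F3) $\neg\neg x=x$; (F4) $\mathsf T\wedge x=x$; (F5) $x\vee\mathsf F=x$; (F6) $\mathsf F\wedge x=\mathsf F$; (F7) $(x\wedge y)\wedge z=x\wedge(y\wedge z)$; (F8) $\neg x\wedge\mathsf F=x\wedge\mathsf F$; (F9) $(x\wedge\mathsf F)\vee y=(x\vee\mathsf T)\wedge y$; (F10) $(x\wedge y)\vee(z\wedge\mathsf F)=(x\vee(z\wedge\mathsf F))\wedge(y\vee(z\wedge\mathsf F))$. Evaluation trees: $\mathcal T_A$ is the least set containing $\mathsf T,\mathsf F$ and all $X\trianglelefteq a\trianglerighteq Y$ ($X,Y\in\mathcal T_A$, $a\in A$; root $a$, left branch $X$, right branch $Y$). Leaf replacement $X[\mathsf T\mapsto Y,\mathsf F\mapsto Z]$ replaces each $\mathsf T$-leaf of $X$ by $Y$ and each $\mathsf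 F$-leaf by $Z$ (unlisted leaves unchanged). The function $se:\mathcal S_A\to\mathcal T_A$: $se(\mathsf T)=\mathsf T$, $se(\mathsf F)=\mathsf F$, $se(a)=\mathsf T\trianglelefteq a\trianglerighteq\mathsf F$, $se(\neg P)=se(P)[\mathsf T\mapsto\mathsf F,\mathsf F\mapsto\mathsf T]$, $se(P\wedge Q)=se(P)[\mathsf T\mapsto se(Q)]$, $se(P\vee Q)=se(P)[\mathsf F\mapsto se(Q)]$. $\mathbb M_{se}$ is the algebra with domain $\{se(P)\mid P\in\mathcal S_A\}$ interpreting the constants and connectives as in the definition of $se$ (so that the value of a closed term $P$ is $se(P)$); $\mathbb M_{se}\models P=Q$ means $P$ and $Q$ have equal interpretation. -}

module Defs where

open import Data.Nat using (ℕ)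

data Term (A : Set) (V : Set) : Set where
  var  : V → Term A V
  `T   : Term A V
  `F   : Term A V
  atom : A → Term A V
  ¬'_  : Term A V → Term A V
  _∧'_ : Term A V → Term A V → Term A V
  _∨'_ : Term A V → Term A V → Term A V

infixr 7 ¬'_
infixr 6 _∧'_
infixr 5 _∨'_

data Empty : Set where

S : Set → Set
S A = Term A Empty

subst : {A V W : Set} → (V → Term A W) → Term A V → Term A W
subst σ (var x)  = σ x
subst σ `T       = `T
subst σ `F       = `F
subst σ (atom a) = atom a
subst σ (¬' t)   = ¬' subst σ t
subst σ (t ∧' u) = subst σ t ∧' subst σ u
subst σ (t ∨' u) = subst σ t ∨' subst σ u

data Var3 : Set where
  x y z : Var3

data Axiom (A : Set) : Term A Var3 → Term A Var3 → Set where
  F1  : Axiom A `F (¬' `T)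
  F2  : Axiom A (var x ∨' var y) (¬' (¬' var x ∧' ¬' var y))
  F3  : Axiom A (¬' ¬' var x) (var x)
  F4  : Axiom A (`T ∧' var x) (var x)
  F5  : Axiom A (var x ∨' `F) (var x)
  F6  : Axiom A (`F ∧' var x) `F
  F7  : Axiom A ((var x ∧' var y) ∧' var z) (var x ∧' (var y ∧' var z))
  F8  : Axiom A (¬' var x ∧' `F) (var x ∧' `F)
  F9  : Axiom A ((var x ∧' `F) ∨' var y) ((var x ∨' `T) ∧' var y)
  F10 : Axiom A ((var x ∧' var y) ∨' (var z ∧' `F))
                ((var x ∨' (var z ∧' `F)) ∧' (var y ∨' (var z ∧' `F)))

infix 4 _⊢_≈_
data _⊢_≈_ (A : Set) {V : Set} : Term A V → Term A V → Set where
  ax    : ∀ {l r} (σ : Var3 → Term A V) → Axiom A l r → A ⊢ subst σ l ≈ subst σ r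
  refl≈ : ∀ {t} → A ⊢ t ≈ t
  sym≈  : ∀ {t u} → A ⊢ t ≈ u → A ⊢ u ≈ t
  trans≈ : ∀ {t u v} → A ⊢ t ≈ u → A ⊢ u ≈ v → A ⊢ t ≈ v
  cong¬ : ∀ {t u} → A ⊢ t ≈ u → A ⊢ ¬' t ≈ ¬' u
  cong∧ : ∀ {t t' u u'} → A ⊢ t ≈ t' → A ⊢ u ≈ u' → A ⊢ t ∧' u ≈ t' ∧' u'
  cong∨ : ∀ {t t' u u'} → A ⊢ t ≈ t' → A ⊢ u ≈ u' → A ⊢ t ∨' u ≈ t' ∨' u'

EqFSCL⊢ : (A : Set) → S A → S A → Set
EqFSCL⊢ A P Q = A ⊢ P ≈ Q

data Tree (A : Set) : Set where
  T F : Tree A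
  node : Tree A → A → Tree A → Tree A   -- node X a Y  =  X ⊴ a ⊵ Y

replace : {A : Set} → Tree A → Tree A → Tree A → Tree A
replace T Y Z = Y
replace F Y Z = Z
replace (node X a X') Y Z = node (replace X Y Z) a (replace X' Y Z)

negT : {A : Set} → Tree A → Tree A
negT X = replace X F T

andT : {A : Set} → Tree A → Tree A → Tree A
andT X Y = replace X Y F

orT : {A : Set} → Tree A → Tree A → Tree A
orT X Y = replace X T Y

se : {A : Set} → S A → Tree A
se (var ())
se `T       = T
se `F       = F
se (atom a) = node T a F
se (¬' P)   = negT (se P)
se (P ∧' Q) = andT (se P) (se Q)
se (P ∨' Q) = orT (se P) (se Q)

⟦_⟧se : {A : Set} → S A → Tree A
⟦ var () ⟧se
⟦ `T ⟧se     = T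
⟦ `F ⟧se     = F
⟦ atom a ⟧se = node T a F
⟦ ¬' P ⟧se   = negT ⟦ P ⟧se
⟦ P ∧' Q ⟧se = andT ⟦ P ⟧se ⟦ Q ⟧se
⟦ P ∨' Q ⟧se = orT ⟦ P ⟧se ⟦ Q ⟧se

module Submission where

-- Soundness: leaf replacement is associative, and every axiom is an instance of this or of
-- X[T ↦ T, F ↦ F] = X.
--
-- Completeness: every term is provably equal to a normal form, which is a T-term, an F-term, or
-- P^T ∧ M with M an ∧/∨-combination of literal terms (ℓ ∧ P^T) ∨ P^F. The key equations are
-- that F-terms absorb whatever is evaluated between them, (P ∨ P^F) ∧ Q^F = R^F, and that
-- T-terms distribute over ∨ from the right. Once chains of the same connective are associated
-- to the right, a normal form is determined by its tree. The tree of M contains both leaves,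
-- so decomposing it along its main connective is unique by an analogue of Levi's lemma for
-- grafting, while literals and operands of the other connective admit no such decomposition.

open import Defs
open import Data.Bool using (Bool; true; false; not)
open import Data.Bool.Properties using (not-involutive; not-¬)
open import Data.Empty using (⊥; ⊥-elim)
open import Data.Nat using (ℕ; suc; _+_; _≤_; _<_; s≤s)
open import Data.Nat.Properties using (≤-refl; ≤-trans; m≤m+n; m≤n+m; n≤1+n; <-irrefl; <-asym)
open import Data.Product using (Σ; _,_; proj₁; proj₂; _×_)
open import Data.Sum using (_⊎_; inj₁; inj₂; [_,_]′; map; map₁)
open import Data.Unit using (⊤; tt)
open import Function using (_∘_; id)
open import Function.Bundles using (_⇔_; mk⇔)
open import Relation.Binary.Bundles using (Setoid)
open import Relation.Binary.PropositionalEquality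
  using (_≡_; _≢_; refl; sym; trans; cong; cong₂; module ≡-Reasoning) renaming (subst to ≡-subst)
open import Relation.Nullary using (¬_; Dec; yes; no)
import Relation.Binary.Reasoning.Setoid as SetoidReasoning

private variable
  A V : Set
  t u v : Term A V

⊢-setoid : (A V : Set) → Setoid _ _
⊢-setoid A V = record
  { Carrier       = Term A V
  ; _≈_           = λ t u → A ⊢ t ≈ u
  ; isEquivalence = record { refl = refl≈ ; sym = sym≈ ; trans = trans≈ }
  }

module ≈-Reasoning {A V : Set} = SetoidReasoning (⊢-setoid A V)

instantiate : Term A V → Term A V → Term A V → Var3 → Term A V
instantiate t u v x = t
instantiate t u v y = u
instantiate t u v z = v

¬T≈F : A ⊢ ¬' `T ≈ `F {V = V}
¬T≈F = sym≈ (ax (instantiate `T `T `T) F1)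

∨≈¬[¬∧¬] : A ⊢ t ∨' u ≈ ¬' (¬' t ∧' ¬' u)
∨≈¬[¬∧¬] {t = t} {u = u} = ax (instantiate t u t) F2

¬-involutive : A ⊢ ¬' ¬' t ≈ t
¬-involutive {t = t} = ax (instantiate t t t) F3

∧-identityˡ : A ⊢ `T ∧' t ≈ t
∧-identityˡ {t = t} = ax (instantiate t t t) F4

∨-identityʳ : A ⊢ t ∨' `F ≈ t
∨-identityʳ {t = t} = ax (instantiate t t t) F5

∧-zeroˡ : A ⊢ `F ∧' t ≈ `F
∧-zeroˡ {t = t} = ax (instantiate t t t) F6

∧-assoc : A ⊢ (t ∧' u) ∧' v ≈ t ∧' (u ∧' v)
∧-assoc {t = t} {u = u} {v = v} = ax (instantiate t u v) F7

¬[-]∧F : A ⊢ ¬' t ∧' `F ≈ t ∧' `F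
¬[-]∧F {t = t} = ax (instantiate t t t) F8

[-∧F]∨ : A ⊢ (t ∧' `F) ∨' u ≈ (t ∨' `T) ∧' u
[-∧F]∨ {t = t} {u = u} = ax (instantiate t u t) F9

∨-distribʳ-∧-F : A ⊢ (t ∧' u) ∨' (v ∧' `F) ≈ (t ∨' (v ∧' `F)) ∧' (u ∨' (v ∧' `F))
∨-distribʳ-∧-F {t = t} {u = u} {v = v} = ax (instantiate t u v) F10

¬F≈T : A ⊢ ¬' `F ≈ `T {V = V}
¬F≈T = trans≈ (cong¬ (sym≈ ¬T≈F)) ¬-involutive

¬-distrib-∧ : A ⊢ ¬' (t ∧' u) ≈ ¬' t ∨' ¬' u
¬-distrib-∧ = sym≈ (trans≈ ∨≈¬[¬∧¬] (cong¬ (cong∧ ¬-involutive ¬-involutive)))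

¬-distrib-∨ : A ⊢ ¬' (t ∨' u) ≈ ¬' t ∧' ¬' u
¬-distrib-∨ = trans≈ (cong¬ ∨≈¬[¬∧¬]) ¬-involutive

∧-identityʳ : A ⊢ t ∧' `T ≈ t
∧-identityʳ {t = t} = begin
  t ∧' `T             ≈⟨ ¬-involutive ⟨
  ¬' ¬' (t ∧' `T)     ≈⟨ cong¬ (trans≈ ¬-distrib-∧ (cong∨ refl≈ ¬T≈F)) ⟩
  ¬' (¬' t ∨' `F)     ≈⟨ cong¬ ∨-identityʳ ⟩
  ¬' ¬' t             ≈⟨ ¬-involutive ⟩
  t                   ∎
  where open ≈-Reasoning

∨-zeroˡ : A ⊢ `T ∨' t ≈ `T
∨-zeroˡ {t = t} = begin
  `T ∨' t             ≈⟨ ∨≈¬[¬∧¬] ⟩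
  ¬' (¬' `T ∧' ¬' t)  ≈⟨ cong¬ (trans≈ (cong∧ ¬T≈F refl≈) ∧-zeroˡ) ⟩
  ¬' `F               ≈⟨ ¬F≈T ⟩
  `T                  ∎
  where open ≈-Reasoning

∨-identityˡ : A ⊢ `F ∨' t ≈ t
∨-identityˡ {t = t} = begin
  `F ∨' t             ≈⟨ ∨≈¬[¬∧¬] ⟩
  ¬' (¬' `F ∧' ¬' t)  ≈⟨ cong¬ (trans≈ (cong∧ ¬F≈T refl≈) ∧-identityˡ) ⟩
  ¬' ¬' t             ≈⟨ ¬-involutive ⟩
  t                   ∎
  where open ≈-Reasoning

∨-assoc : A ⊢ (t ∨' u) ∨' v ≈ t ∨' (u ∨' v)
∨-assoc {t = t} {u = u} {v = v} = begin
  (t ∨' u) ∨' v                ≈⟨ ∨≈¬[¬∧¬] ⟩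
  ¬' (¬' (t ∨' u) ∧' ¬' v)     ≈⟨ cong¬ (cong∧ ¬-distrib-∨ refl≈) ⟩
  ¬' ((¬' t ∧' ¬' u) ∧' ¬' v)  ≈⟨ cong¬ ∧-assoc ⟩
  ¬' (¬' t ∧' (¬' u ∧' ¬' v))  ≈⟨ cong¬ (cong∧ refl≈ ¬-distrib-∨) ⟨
  ¬' (¬' t ∧' ¬' (u ∨' v))     ≈⟨ ∨≈¬[¬∧¬] ⟨
  t ∨' (u ∨' v)                ∎
  where open ≈-Reasoning

¬[-]∨T : A ⊢ ¬' t ∨' `T ≈ t ∨' `T
¬[-]∨T {t = t} = begin
  ¬' t ∨' `T           ≈⟨ cong∨ refl≈ ¬F≈T ⟨
  ¬' t ∨' ¬' `F        ≈⟨ ¬-distrib-∧ ⟨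
  ¬' (t ∧' `F)         ≈⟨ cong¬ ¬[-]∧F ⟨
  ¬' (¬' t ∧' `F)      ≈⟨ ¬-distrib-∧ ⟩
  ¬' ¬' t ∨' ¬' `F     ≈⟨ cong∨ ¬-involutive ¬F≈T ⟩
  t ∨' `T              ∎
  where open ≈-Reasoning

¬[-∧F] : A ⊢ ¬' (t ∧' `F) ≈ t ∨' `T
¬[-∧F] = trans≈ ¬-distrib-∧ (trans≈ (cong∨ refl≈ ¬F≈T) ¬[-]∨T)

¬[¬-∨¬-] : A ⊢ ¬' (¬' t ∨' ¬' u) ≈ t ∧' u
¬[¬-∨¬-] = trans≈ ¬-distrib-∨ (cong∧ ¬-involutive ¬-involutive)

¬[-∨T] : A ⊢ ¬' (t ∨' `T) ≈ t ∧' `F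
¬[-∨T] = trans≈ ¬-distrib-∨ (trans≈ (cong∧ refl≈ ¬T≈F) ¬[-]∧F)

¬≈∧F : A ⊢ v ≈ v ∨' `T → A ⊢ ¬' v ≈ v ∧' `F
¬≈∧F v≈v∨T = trans≈ (cong¬ v≈v∨T) ¬[-∨T]

∨-distribʳ-∧ : A ⊢ v ≈ v ∧' `F → A ⊢ (t ∧' u) ∨' v ≈ (t ∨' v) ∧' (u ∨' v)
∨-distribʳ-∧ {v = v} {t = t} {u = u} v≈v∧F = begin
  (t ∧' u) ∨' v                          ≈⟨ cong∨ refl≈ v≈v∧F ⟩
  (t ∧' u) ∨' (v ∧' `F)                  ≈⟨ ∨-distribʳ-∧-F ⟩
  (t ∨' (v ∧' `F)) ∧' (u ∨' (v ∧' `F))   ≈⟨ cong∧ (cong∨ refl≈ v≈v∧F) (cong∨ refl≈ v≈v∧F) ⟨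
  (t ∨' v) ∧' (u ∨' v)                   ∎
  where open ≈-Reasoning

∧-distribʳ-∨ : A ⊢ v ≈ v ∨' `T → A ⊢ (t ∨' u) ∧' v ≈ (t ∧' v) ∨' (u ∧' v)
∧-distribʳ-∨ {v = v} {t = t} {u = u} v≈v∨T = begin
  (t ∨' u) ∧' v                          ≈⟨ ¬-involutive ⟨
  ¬' ¬' ((t ∨' u) ∧' v)                  ≈⟨ cong¬ (trans≈ ¬-distrib-∧ (cong∨ ¬-distrib-∨ refl≈)) ⟩
  ¬' ((¬' t ∧' ¬' u) ∨' ¬' v)            ≈⟨ cong¬ (∨-distribʳ-∧ (trans≈ (¬≈∧F v≈v∨T) (sym≈ ¬[-]∧F))) ⟩
  ¬' ((¬' t ∨' ¬' v) ∧' (¬' u ∨' ¬' v))  ≈⟨ trans≈ ¬-distrib-∧ (cong∨ ¬[¬-∨¬-] ¬[¬-∨¬-]) ⟩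
  (t ∧' v) ∨' (u ∧' v)                   ∎
  where open ≈-Reasoning

[∨]∧F : A ⊢ (t ∨' u) ∧' `F ≈ ¬' t ∧' (u ∧' `F)
[∨]∧F {t = t} {u = u} = begin
  (t ∨' u) ∧' `F               ≈⟨ cong∧ ∨≈¬[¬∧¬] refl≈ ⟩
  ¬' (¬' t ∧' ¬' u) ∧' `F      ≈⟨ ¬[-]∧F ⟩
  (¬' t ∧' ¬' u) ∧' `F         ≈⟨ ∧-assoc ⟩
  ¬' t ∧' (¬' u ∧' `F)         ≈⟨ cong∧ refl≈ ¬[-]∧F ⟩
  ¬' t ∧' (u ∧' `F)            ∎
  where open ≈-Reasoning

[∨[-∧F]]∧F : A ⊢ (t ∨' (u ∧' `F)) ∧' `F ≈ (t ∨' u) ∧' `F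
[∨[-∧F]]∧F {t = t} {u = u} = begin
  (t ∨' (u ∧' `F)) ∧' `F       ≈⟨ [∨]∧F ⟩
  ¬' t ∧' ((u ∧' `F) ∧' `F)    ≈⟨ cong∧ refl≈ (trans≈ ∧-assoc (cong∧ refl≈ ∧-zeroˡ)) ⟩
  ¬' t ∧' (u ∧' `F)            ≈⟨ [∨]∧F ⟨
  (t ∨' u) ∧' `F               ∎
  where open ≈-Reasoning

-- Both sides evaluate t and then run u ∧ F if t yields T, and v ∧ F otherwise.
∨-∧F-swap : A ⊢ u ≈ u ∨' `T → A ⊢ v ≈ v ∨' `T →
            A ⊢ (t ∨' (v ∧' `F)) ∧' (u ∧' `F) ≈ (¬' t ∨' (u ∧' `F)) ∧' (v ∧' `F)
∨-∧F-swap {u = u} {v = v} {t = t} u≈u∨T v≈v∨T = begin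
  (t ∨' (v ∧' `F)) ∧' (u ∧' `F)               ≈⟨ ∧-assoc ⟨
  ((t ∨' (v ∧' `F)) ∧' u) ∧' `F               ≈⟨ cong∧ (∧-distribʳ-∨ u≈u∨T) refl≈ ⟩
  ((t ∧' u) ∨' ((v ∧' `F) ∧' u)) ∧' `F
    ≈⟨ cong∧ (cong∨ refl≈ (trans≈ ∧-assoc (cong∧ refl≈ ∧-zeroˡ))) refl≈ ⟩
  ((t ∧' u) ∨' (v ∧' `F)) ∧' `F               ≈⟨ ¬[-]∧F ⟨
  ¬' ((t ∧' u) ∨' (v ∧' `F)) ∧' `F            ≈⟨ cong∧ ¬-distrib-∨ refl≈ ⟩
  (¬' (t ∧' u) ∧' ¬' (v ∧' `F)) ∧' `F         ≈⟨ cong∧ (cong∧ ¬-distrib-∧ (trans≈ ¬[-∧F] (sym≈ v≈v∨T))) refl≈ ⟩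
  ((¬' t ∨' ¬' u) ∧' v) ∧' `F                 ≈⟨ cong∧ (cong∧ (cong∨ refl≈ (¬≈∧F u≈u∨T)) refl≈) refl≈ ⟩
  ((¬' t ∨' (u ∧' `F)) ∧' v) ∧' `F            ≈⟨ ∧-assoc ⟩
  (¬' t ∨' (u ∧' `F)) ∧' (v ∧' `F)            ∎
  where open ≈-Reasoning

private variable
  U U′ W K X X′ Y Y′ Y₁ Y₂ Y₁′ Y₂′ Z Z′ W₀ W₁ W₂ : Tree A

replace-replace : ∀ (X : Tree A) → replace (replace X Y Z) W₁ W₀ ≡ replace X (replace Y W₁ W₀) (replace Z W₁ W₀)
replace-replace T            = refl
replace-replace F            = refl
replace-replace (node X a Y) = cong₂ (λ l r → node l a r) (replace-replace X) (replace-replace Y)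

replace-identity : ∀ (X : Tree A) → replace X T F ≡ X
replace-identity T            = refl
replace-identity F            = refl
replace-identity (node X a Y) = cong₂ (λ l r → node l a r) (replace-identity X) (replace-identity Y)

negT-involutive : ∀ (X : Tree A) → negT (negT X) ≡ X
negT-involutive X = trans (replace-replace X) (replace-identity X)

se-axiom : ∀ {l r} (σ : Var3 → S A) → Axiom A l r → se (subst σ l) ≡ se (subst σ r)
se-axiom σ F1  = refl
se-axiom σ F2  = sym (trans (replace-replace (negT (se (σ x))))
  (trans (replace-replace (se (σ x))) (cong (replace (se (σ x)) T) (negT-involutive (se (σ y))))))
se-axiom σ F3  = negT-involutive (se (σ x))
se-axiom σ F4  = refl
se-axiom σ F5  = replace-identity (se (σ x))
se-axiom σ F6  = refl
se-axiom σ F7  = replace-replace (se (σ x))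
se-axiom σ F8  = replace-replace (se (σ x))
se-axiom σ F9  = trans (replace-replace (se (σ x))) (sym (replace-replace (se (σ x))))
se-axiom σ F10 = trans (replace-replace (se (σ x)))
  (trans (cong (replace (se (σ x)) _) (sym (replace-replace (se (σ z))))) (sym (replace-replace (se (σ x)))))

se-sound : {P Q : S A} → A ⊢ P ≈ Q → se P ≡ se Q
se-sound (ax σ a)       = se-axiom σ a
se-sound refl≈          = refl
se-sound (sym≈ e)       = sym (se-sound e)
se-sound (trans≈ e e′)  = trans (se-sound e) (se-sound e′)
se-sound (cong¬ e)      = cong negT (se-sound e)
se-sound (cong∧ e e′)   = cong₂ andT (se-sound e) (se-sound e′)
se-sound (cong∨ e e′)   = cong₂ orT (se-sound e) (se-sound e′)

⟦⟧se≡se : ∀ (P : S A) → ⟦ P ⟧se ≡ se P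
⟦⟧se≡se `T       = refl
⟦⟧se≡se `F       = refl
⟦⟧se≡se (atom a) = refl
⟦⟧se≡se (¬' P)   = cong negT (⟦⟧se≡se P)
⟦⟧se≡se (P ∧' Q) = cong₂ andT (⟦⟧se≡se P) (⟦⟧se≡se Q)
⟦⟧se≡se (P ∨' Q) = cong₂ orT (⟦⟧se≡se P) (⟦⟧se≡se Q)

-- A T-term (F-term) is a term built from atoms by ∧ and ∨ that always yields T (F).
-- It is determined by the shape of its evaluation tree, so both are indexed by a tree
-- whose leaf labels are ignored.
T-term : Tree A → S A
T-term T            = `T
T-term F            = `T
T-term (node X a Y) = (atom a ∧' T-term X) ∨' T-term Y

F-term : Tree A → S A
F-term T            = `F
F-term F            = `F
F-term (node X a Y) = (atom a ∨' F-term Y) ∧' F-term X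

T-term-∨-zeroˡ : ∀ (U : Tree A) {P : S A} → A ⊢ T-term U ∨' P ≈ T-term U
T-term-∨-zeroˡ T            = ∨-zeroˡ
T-term-∨-zeroˡ F            = ∨-zeroˡ
T-term-∨-zeroˡ (node X a Y) = trans≈ ∨-assoc (cong∨ refl≈ (T-term-∨-zeroˡ Y))

F-term-∧-zeroˡ : ∀ (U : Tree A) {P : S A} → A ⊢ F-term U ∧' P ≈ F-term U
F-term-∧-zeroˡ T            = ∧-zeroˡ
F-term-∧-zeroˡ F            = ∧-zeroˡ
F-term-∧-zeroˡ (node X a Y) = trans≈ ∧-assoc (cong∧ refl≈ (F-term-∧-zeroˡ X))

T-term≈T-term∨T : ∀ (U : Tree A) → A ⊢ T-term U ≈ T-term U ∨' `T
T-term≈T-term∨T U = sym≈ (T-term-∨-zeroˡ U)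

F-term≈T-term∧F : ∀ (U : Tree A) → A ⊢ F-term U ≈ T-term U ∧' `F
F-term≈T-term∧F T            = sym≈ ∧-identityˡ
F-term≈T-term∧F F            = sym≈ ∧-identityˡ
F-term≈T-term∧F (node X a Y) = begin
  (atom a ∨' F-term Y) ∧' F-term X                      ≈⟨ cong∧ refl≈ (F-term≈T-term∧F X) ⟩
  (atom a ∨' F-term Y) ∧' (T-term X ∧' `F)              ≈⟨ ∧-assoc ⟨
  ((atom a ∨' F-term Y) ∧' T-term X) ∧' `F              ≈⟨ cong∧ (∧-distribʳ-∨ (T-term≈T-term∨T X)) refl≈ ⟩
  ((atom a ∧' T-term X) ∨' (F-term Y ∧' T-term X)) ∧' `F ≈⟨ cong∧ (cong∨ refl≈ (F-term-∧-zeroˡ Y)) refl≈ ⟩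
  ((atom a ∧' T-term X) ∨' F-term Y) ∧' `F              ≈⟨ cong∧ (cong∨ refl≈ (F-term≈T-term∧F Y)) refl≈ ⟩
  ((atom a ∧' T-term X) ∨' (T-term Y ∧' `F)) ∧' `F      ≈⟨ [∨[-∧F]]∧F ⟩
  ((atom a ∧' T-term X) ∨' T-term Y) ∧' `F              ∎
  where open ≈-Reasoning

F-term≈F-term∧F : ∀ (U : Tree A) → A ⊢ F-term U ≈ F-term U ∧' `F
F-term≈F-term∧F U = sym≈ (F-term-∧-zeroˡ U)

F-term-swap : ∀ (U W : Tree A) {P : S A} →
              A ⊢ (P ∨' F-term W) ∧' F-term U ≈ (¬' P ∨' F-term U) ∧' F-term W
F-term-swap U W = trans≈ (cong∧ (cong∨ refl≈ (F-term≈T-term∧F W)) (F-term≈T-term∧F U))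
  (trans≈ (∨-∧F-swap (T-term≈T-term∨T U) (T-term≈T-term∨T W))
          (sym≈ (cong∧ (cong∨ refl≈ (F-term≈T-term∧F U)) (F-term≈T-term∧F W))))

¬T-term≈F-term : ∀ (U : Tree A) → A ⊢ ¬' T-term U ≈ F-term U
¬T-term≈F-term T            = ¬T≈F
¬T-term≈F-term F            = ¬T≈F
¬T-term≈F-term (node X a Y) = begin
  ¬' ((atom a ∧' T-term X) ∨' T-term Y)      ≈⟨ ¬-distrib-∨ ⟩
  ¬' (atom a ∧' T-term X) ∧' ¬' T-term Y
    ≈⟨ cong∧ (trans≈ ¬-distrib-∧ (cong∨ refl≈ (¬T-term≈F-term X))) (¬T-term≈F-term Y) ⟩
  (¬' atom a ∨' F-term X) ∧' F-term Y        ≈⟨ F-term-swap Y X ⟩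
  (¬' ¬' atom a ∨' F-term Y) ∧' F-term X     ≈⟨ cong∧ (cong∨ ¬-involutive refl≈) refl≈ ⟩
  (atom a ∨' F-term Y) ∧' F-term X           ∎
  where open ≈-Reasoning

¬F-term≈T-term : ∀ (U : Tree A) → A ⊢ ¬' F-term U ≈ T-term U
¬F-term≈T-term U = trans≈ (cong¬ (sym≈ (¬T-term≈F-term U))) ¬-involutive

F-term∨≈T-term∧ : ∀ (U : Tree A) {P : S A} → A ⊢ F-term U ∨' P ≈ T-term U ∧' P
F-term∨≈T-term∧ U = trans≈ (cong∨ (F-term≈T-term∧F U) refl≈)
  (trans≈ [-∧F]∨ (cong∧ (sym≈ (T-term≈T-term∨T U)) refl≈))

T-term∧T-term : ∀ (U W : Tree A) → A ⊢ T-term U ∧' T-term W ≈ T-term (replace U W W)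
T-term∧T-term T            W = ∧-identityˡ
T-term∧T-term F            W = ∧-identityˡ
T-term∧T-term (node X a Y) W = begin
  ((atom a ∧' T-term X) ∨' T-term Y) ∧' T-term W             ≈⟨ ∧-distribʳ-∨ (T-term≈T-term∨T W) ⟩
  ((atom a ∧' T-term X) ∧' T-term W) ∨' (T-term Y ∧' T-term W)
    ≈⟨ cong∨ (trans≈ ∧-assoc (cong∧ refl≈ (T-term∧T-term X W))) (T-term∧T-term Y W) ⟩
  (atom a ∧' T-term (replace X W W)) ∨' T-term (replace Y W W) ∎
  where open ≈-Reasoning

-- Generalised to both leaf replacements so that the negation case can swap them.
F-term-Sandwich : S A → Set
F-term-Sandwich {A} P = ∀ (W₁ W₀ : Tree A) →
  A ⊢ (P ∨' F-term W₀) ∧' F-term W₁ ≈ F-term (replace (se P) W₁ W₀)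

sandwich-¬ : {P : S A} → F-term-Sandwich P → F-term-Sandwich (¬' P)
sandwich-¬ {P = P} sP W₁ W₀ = begin
  (¬' P ∨' F-term W₀) ∧' F-term W₁      ≈⟨ F-term-swap W₁ W₀ ⟩
  (¬' ¬' P ∨' F-term W₁) ∧' F-term W₀   ≈⟨ cong∧ (cong∨ ¬-involutive refl≈) refl≈ ⟩
  (P ∨' F-term W₁) ∧' F-term W₀         ≈⟨ sP W₀ W₁ ⟩
  F-term (replace (se P) W₀ W₁)         ≡⟨ cong F-term (replace-replace (se P)) ⟨
  F-term (replace (negT (se P)) W₁ W₀)  ∎
  where open ≈-Reasoning

sandwich-∧ : {P Q : S A} → F-term-Sandwich P → F-term-Sandwich Q → F-term-Sandwich (P ∧' Q)
sandwich-∧ {P = P} {Q} sP sQ W₁ W₀ = begin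
  ((P ∧' Q) ∨' F-term W₀) ∧' F-term W₁               ≈⟨ cong∧ (∨-distribʳ-∧ (F-term≈F-term∧F W₀)) refl≈ ⟩
  ((P ∨' F-term W₀) ∧' (Q ∨' F-term W₀)) ∧' F-term W₁ ≈⟨ ∧-assoc ⟩
  (P ∨' F-term W₀) ∧' ((Q ∨' F-term W₀) ∧' F-term W₁) ≈⟨ cong∧ refl≈ (sQ W₁ W₀) ⟩
  (P ∨' F-term W₀) ∧' F-term (replace (se Q) W₁ W₀)   ≈⟨ sP _ W₀ ⟩
  F-term (replace (se P) (replace (se Q) W₁ W₀) W₀)   ≡⟨ cong F-term (replace-replace (se P)) ⟨
  F-term (replace (andT (se P) (se Q)) W₁ W₀)         ∎
  where open ≈-Reasoning

sandwich-≈ : {P Q : S A} → A ⊢ P ≈ Q → F-term-Sandwich P → F-term-Sandwich Q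
sandwich-≈ {P = P} {Q} P≈Q sP W₁ W₀ = begin
  (Q ∨' F-term W₀) ∧' F-term W₁     ≈⟨ cong∧ (cong∨ P≈Q refl≈) refl≈ ⟨
  (P ∨' F-term W₀) ∧' F-term W₁     ≈⟨ sP W₁ W₀ ⟩
  F-term (replace (se P) W₁ W₀)     ≡⟨ cong (λ X → F-term (replace X W₁ W₀)) (se-sound P≈Q) ⟩
  F-term (replace (se Q) W₁ W₀)     ∎
  where open ≈-Reasoning

sandwich : ∀ (P : S A) → F-term-Sandwich P
sandwich `T       W₁ W₀ = trans≈ (cong∧ ∨-zeroˡ refl≈) ∧-identityˡ
sandwich `F       W₁ W₀ = trans≈ (cong∧ ∨-identityˡ refl≈) (F-term-∧-zeroˡ W₀)
sandwich (atom a) W₁ W₀ = refl≈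
sandwich (¬' P)   = sandwich-¬ (sandwich P)
sandwich (P ∧' Q) = sandwich-∧ (sandwich P) (sandwich Q)
sandwich (P ∨' Q) = sandwich-≈ (sym≈ ∨≈¬[¬∧¬])
  (sandwich-¬ (sandwich-∧ (sandwich-¬ (sandwich P)) (sandwich-¬ (sandwich Q))))

-- The Boolean in op selects ∧ (true) or ∨ (false); on trees these graft at the T-leaves,
-- respectively the F-leaves, which lets one argument treat both connectives.
data Mixed (A : Set) : Set where
  lit : (polarity : Bool) → A → (U V : Tree A) → Mixed A
  op  : Bool → Mixed A → Mixed A → Mixed A

data NF (A : Set) : Set where
  T-nf F-nf : Tree A → NF A
  M-nf      : Tree A → Mixed A → NF A

literal : Bool → A → S A
literal true  a = atom a
literal false a = ¬' atom a

connective : Bool → S A → S A → S A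
connective true  = _∧'_
connective false = _∨'_

⌜_⌝ᴹ : Mixed A → S A
⌜ lit p a U V ⌝ᴹ = (literal p a ∧' T-term U) ∨' F-term V
⌜ op b M N ⌝ᴹ    = connective b ⌜ M ⌝ᴹ ⌜ N ⌝ᴹ

⌜_⌝ : NF A → S A
⌜ T-nf U ⌝   = T-term U
⌜ F-nf U ⌝   = F-term U
⌜ M-nf U M ⌝ = T-term U ∧' ⌜ M ⌝ᴹ

NormalFormOf : S A → Set
NormalFormOf {A} P = Σ (NF A) λ n → A ⊢ P ≈ ⌜ n ⌝

negᴹ : Mixed A → Mixed A
negᴹ (lit p a U V) = lit (not p) a V U
negᴹ (op b M N)    = op (not b) (negᴹ M) (negᴹ N)

¬-literal : ∀ p (a : A) → A ⊢ ¬' literal p a ≈ literal (not p) a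
¬-literal true  a = refl≈
¬-literal false a = ¬-involutive

¬-negᴹ : ∀ (M : Mixed A) → A ⊢ ¬' ⌜ M ⌝ᴹ ≈ ⌜ negᴹ M ⌝ᴹ
¬-negᴹ (lit p a U V) = begin
  ¬' ((literal p a ∧' T-term U) ∨' F-term V)                 ≈⟨ ¬-distrib-∨ ⟩
  ¬' (literal p a ∧' T-term U) ∧' ¬' F-term V
    ≈⟨ cong∧ (trans≈ ¬-distrib-∧ (cong∨ (¬-literal p a) (¬T-term≈F-term U))) (¬F-term≈T-term V) ⟩
  (literal (not p) a ∨' F-term U) ∧' T-term V                ≈⟨ ∧-distribʳ-∨ (T-term≈T-term∨T V) ⟩
  (literal (not p) a ∧' T-term V) ∨' (F-term U ∧' T-term V)  ≈⟨ cong∨ refl≈ (F-term-∧-zeroˡ U) ⟩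
  (literal (not p) a ∧' T-term V) ∨' F-term U                ∎
  where open ≈-Reasoning
¬-negᴹ (op true M N)  = trans≈ ¬-distrib-∧ (cong∨ (¬-negᴹ M) (¬-negᴹ N))
¬-negᴹ (op false M N) = trans≈ ¬-distrib-∨ (cong∧ (¬-negᴹ M) (¬-negᴹ N))

∧ᴹ-T-term : Mixed A → Tree A → Mixed A
∧ᴹ-T-term (lit p a U V)   W = lit p a (replace U W W) V
∧ᴹ-T-term (op true M N)   W = op true M (∧ᴹ-T-term N W)
∧ᴹ-T-term (op false M N)  W = op false (∧ᴹ-T-term M W) (∧ᴹ-T-term N W)

∧-∧ᴹ-T-term : ∀ (M : Mixed A) W → A ⊢ ⌜ M ⌝ᴹ ∧' T-term W ≈ ⌜ ∧ᴹ-T-term M W ⌝ᴹ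
∧-∧ᴹ-T-term (lit p a U V) W = begin
  ((literal p a ∧' T-term U) ∨' F-term V) ∧' T-term W                ≈⟨ ∧-distribʳ-∨ (T-term≈T-term∨T W) ⟩
  ((literal p a ∧' T-term U) ∧' T-term W) ∨' (F-term V ∧' T-term W)
    ≈⟨ cong∨ (trans≈ ∧-assoc (cong∧ refl≈ (T-term∧T-term U W))) (F-term-∧-zeroˡ V) ⟩
  (literal p a ∧' T-term (replace U W W)) ∨' F-term V                ∎
  where open ≈-Reasoning
∧-∧ᴹ-T-term (op true M N)  W = trans≈ ∧-assoc (cong∧ refl≈ (∧-∧ᴹ-T-term N W))
∧-∧ᴹ-T-term (op false M N) W =
  trans≈ (∧-distribʳ-∨ (T-term≈T-term∨T W)) (cong∨ (∧-∧ᴹ-T-term M W) (∧-∧ᴹ-T-term N W))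

¬-nf : ∀ (n : NF A) → NormalFormOf (¬' ⌜ n ⌝)
¬-nf (T-nf U)   = F-nf U , ¬T-term≈F-term U
¬-nf (F-nf U)   = T-nf U , ¬F-term≈T-term U
¬-nf (M-nf U M) = M-nf U (negᴹ M) ,
  trans≈ ¬-distrib-∧ (trans≈ (cong∨ (¬T-term≈F-term U) (¬-negᴹ M)) (F-term∨≈T-term∧ U))

∧-nf : ∀ (n m : NF A) → NormalFormOf (⌜ n ⌝ ∧' ⌜ m ⌝)
∧-nf n          (F-nf W)   = F-nf (replace (se ⌜ n ⌝) W T) ,
  trans≈ (cong∧ (sym≈ ∨-identityʳ) refl≈) (sandwich ⌜ n ⌝ W T)
∧-nf (F-nf U)   (T-nf W)   = F-nf U , F-term-∧-zeroˡ U
∧-nf (F-nf U)   (M-nf W M) = F-nf U , F-term-∧-zeroˡ U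
∧-nf (T-nf U)   (T-nf W)   = T-nf (replace U W W) , T-term∧T-term U W
∧-nf (T-nf U)   (M-nf W M) = M-nf (replace U W W) M , trans≈ (sym≈ ∧-assoc) (cong∧ (T-term∧T-term U W) refl≈)
∧-nf (M-nf U M) (T-nf W)   = M-nf U (∧ᴹ-T-term M W) , trans≈ ∧-assoc (cong∧ refl≈ (∧-∧ᴹ-T-term M W))
∧-nf (M-nf U M) (M-nf W N) = M-nf U (op true (∧ᴹ-T-term M W) N) ,
  trans≈ ∧-assoc (cong∧ refl≈ (trans≈ (sym≈ ∧-assoc) (cong∧ (∧-∧ᴹ-T-term M W) refl≈)))

∨-nf : ∀ (n m : NF A) → NormalFormOf (⌜ n ⌝ ∨' ⌜ m ⌝)
∨-nf n m =
  let n′ , ¬n≈n′ = ¬-nf n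
      m′ , ¬m≈m′ = ¬-nf m
      k  , n′∧m′≈k = ∧-nf n′ m′
      r  , ¬k≈r = ¬-nf k
  in r , trans≈ ∨≈¬[¬∧¬] (trans≈ (cong¬ (trans≈ (cong∧ ¬n≈n′ ¬m≈m′) n′∧m′≈k)) ¬k≈r)

normalise : ∀ (P : S A) → NormalFormOf P
normalise `T       = T-nf T , refl≈
normalise `F       = F-nf T , refl≈
normalise (atom a) = M-nf T (lit true a T T) , sym≈ (trans≈ ∧-identityˡ (trans≈ ∨-identityʳ ∧-identityʳ))
normalise (¬' P) =
  let n , P≈n  = normalise P
      m , ¬n≈m = ¬-nf n
  in m , trans≈ (cong¬ P≈n) ¬n≈m
normalise (P ∧' Q) =
  let n , P≈n   = normalise P
      m , Q≈m   = normalise Q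
      k , n∧m≈k = ∧-nf n m
  in k , trans≈ (cong∧ P≈n Q≈m) n∧m≈k
normalise (P ∨' Q) =
  let n , P≈n   = normalise P
      m , Q≈m   = normalise Q
      k , n∨m≈k = ∨-nf n m
  in k , trans≈ (cong∨ P≈n Q≈m) n∨m≈k

-- Chains of the same connective are associated to the right.
NotOp : Bool → Mixed A → Set
NotOp b (lit _ _ _ _) = ⊤
NotOp b (op c _ _)    = c ≡ not b

data Canonical {A : Set} : Mixed A → Set where
  lit : ∀ {p a U V} → Canonical (lit p a U V)
  op  : ∀ {b M N} → NotOp b M → Canonical M → Canonical N → Canonical (op b M N)

connective-cong : ∀ b {P P′ Q Q′ : S A} → A ⊢ P ≈ P′ → A ⊢ Q ≈ Q′ → A ⊢ connective b P Q ≈ connective b P′ Q′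
connective-cong true  = cong∧
connective-cong false = cong∨

CanonicalFormOf : S A → Set
CanonicalFormOf {A} P = Σ (Mixed A) λ K → Canonical K × A ⊢ P ≈ ⌜ K ⌝ᴹ

op-canonical : ∀ b {M N : Mixed A} → Canonical M → Canonical N → CanonicalFormOf (connective b ⌜ M ⌝ᴹ ⌜ N ⌝ᴹ)
op-canonical b     {lit p a U V}   lit          cN = op b (lit p a U V) _ , op tt lit cN , refl≈
op-canonical true  {op true M₁ M₂} (op o c₁ c₂) cN with op-canonical true c₂ cN
... | K , cK , e = op true M₁ K , op o c₁ cK , trans≈ ∧-assoc (cong∧ refl≈ e)
op-canonical false {op false M₁ M₂} (op o c₁ c₂) cN with op-canonical false c₂ cN
... | K , cK , e = op false M₁ K , op o c₁ cK , trans≈ ∨-assoc (cong∨ refl≈ e)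
op-canonical true  {op false M₁ M₂} cM cN = op true (op false M₁ M₂) _ , op refl cM cN , refl≈
op-canonical false {op true M₁ M₂}  cM cN = op false (op true M₁ M₂) _ , op refl cM cN , refl≈

canonicalise : ∀ (M : Mixed A) → CanonicalFormOf ⌜ M ⌝ᴹ
canonicalise (lit p a U V) = lit p a U V , lit , refl≈
canonicalise (op b M N) =
  let M′ , cM′ , M≈M′ = canonicalise M
      N′ , cN′ , N≈N′ = canonicalise N
      K  , cK  , e    = op-canonical b cM′ cN′
  in K , cK , trans≈ (connective-cong b M≈M′ N≈N′) e

private variable
  b c : Bool

leaf : Bool → Tree A
leaf true  = T
leaf false = F

infixl 8 _[_↦_]
_[_↦_] : Tree A → Bool → Tree A → Tree A
node X a Y [ b     ↦ Z ] = node (X [ b ↦ Z ]) a (Y [ b ↦ Z ])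
T          [ true  ↦ Z ] = Z
F          [ true  ↦ Z ] = F
T          [ false ↦ Z ] = T
F          [ false ↦ Z ] = Z

infix 4 _∈ˡ_ _∉ˡ_
data _∈ˡ_ {A : Set} : Bool → Tree A → Set where
  T-leaf : true ∈ˡ T
  F-leaf : false ∈ˡ F
  left   : ∀ {X a Y} → b ∈ˡ X → b ∈ˡ node X a Y
  right  : ∀ {X a Y} → b ∈ˡ Y → b ∈ˡ node X a Y

_∉ˡ_ : Bool → Tree A → Set
b ∉ˡ X = ¬ b ∈ˡ X

size : Tree A → ℕ
size T            = 0
size F            = 0
size (node X a Y) = suc (size X + size Y)

node-injective : ∀ {a a′ : A} → node X a Y ≡ node X′ a′ Y′ → X ≡ X′ × a ≡ a′ × Y ≡ Y′
node-injective refl = refl , refl , refl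

[true↦]≡andT : ∀ (X : Tree A) → X [ true ↦ Z ] ≡ andT X Z
[true↦]≡andT T            = refl
[true↦]≡andT F            = refl
[true↦]≡andT (node X a Y) = cong₂ (λ l r → node l a r) ([true↦]≡andT X) ([true↦]≡andT Y)

[false↦]≡orT : ∀ (X : Tree A) → X [ false ↦ Z ] ≡ orT X Z
[false↦]≡orT T            = refl
[false↦]≡orT F            = refl
[false↦]≡orT (node X a Y) = cong₂ (λ l r → node l a r) ([false↦]≡orT X) ([false↦]≡orT Y)

leaf[↦] : ∀ b → leaf b [ b ↦ Z ] ≡ Z
leaf[↦] true  = refl
leaf[↦] false = refl

[↦leaf] : ∀ b (X : Tree A) → X [ b ↦ leaf b ] ≡ X
[↦leaf] b     (node X a Y) = cong₂ (λ l r → node l a r) ([↦leaf] b X) ([↦leaf] b Y)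
[↦leaf] true  T            = refl
[↦leaf] true  F            = refl
[↦leaf] false T            = refl
[↦leaf] false F            = refl

[↦]-assoc : ∀ b (X : Tree A) → X [ b ↦ Y ] [ b ↦ Z ] ≡ X [ b ↦ Y [ b ↦ Z ] ]
[↦]-assoc b     (node X a X′) = cong₂ (λ l r → node l a r) ([↦]-assoc b X) ([↦]-assoc b X′)
[↦]-assoc true  T             = refl
[↦]-assoc true  F             = refl
[↦]-assoc false T             = refl
[↦]-assoc false F             = refl

[↦]-free : ∀ b (X : Tree A) → b ∉ˡ X → X [ b ↦ Z ] ≡ X
[↦]-free b     (node X a Y) ∉XaY =
  cong₂ (λ l r → node l a r) ([↦]-free b X (∉XaY ∘ left)) ([↦]-free b Y (∉XaY ∘ right))
[↦]-free true  T            ∉T   = ⊥-elim (∉T T-leaf)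
[↦]-free true  F            _    = refl
[↦]-free false T            _    = refl
[↦]-free false F            ∉F   = ⊥-elim (∉F F-leaf)

∈ˡ-[↦] : b ∈ˡ X → c ∈ˡ Z → c ∈ˡ X [ b ↦ Z ]
∈ˡ-[↦] T-leaf     ∈Z = ∈Z
∈ˡ-[↦] F-leaf     ∈Z = ∈Z
∈ˡ-[↦] (left ∈X)  ∈Z = left (∈ˡ-[↦] ∈X ∈Z)
∈ˡ-[↦] (right ∈Y) ∈Z = right (∈ˡ-[↦] ∈Y ∈Z)

not∈ˡ-[↦] : ∀ b (X : Tree A) → not b ∈ˡ X → not b ∈ˡ X [ b ↦ Z ]
not∈ˡ-[↦] b     (node X a Y) (left ∈X)  = left (not∈ˡ-[↦] b X ∈X)
not∈ˡ-[↦] b     (node X a Y) (right ∈Y) = right (not∈ˡ-[↦] b Y ∈Y)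
not∈ˡ-[↦] true  F            F-leaf     = F-leaf
not∈ˡ-[↦] false T            T-leaf     = T-leaf

∈ˡ-[↦]⁻ : ∀ b (X : Tree A) → b ∈ˡ X [ b ↦ Z ] → b ∈ˡ Z
∈ˡ-[↦]⁻ b     (node X a Y) (left h)  = ∈ˡ-[↦]⁻ b X h
∈ˡ-[↦]⁻ b     (node X a Y) (right h) = ∈ˡ-[↦]⁻ b Y h
∈ˡ-[↦]⁻ true  T            h         = h
∈ˡ-[↦]⁻ false F            h         = h

not∈ˡ-[↦]⁻ : ∀ b (X : Tree A) → not b ∈ˡ X [ b ↦ Z ] → not b ∈ˡ X ⊎ not b ∈ˡ Z
not∈ˡ-[↦]⁻ b     (node X a Y) (left h)  = map₁ left (not∈ˡ-[↦]⁻ b X h)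
not∈ˡ-[↦]⁻ b     (node X a Y) (right h) = map₁ right (not∈ˡ-[↦]⁻ b Y h)
not∈ˡ-[↦]⁻ true  T            h         = inj₂ h
not∈ˡ-[↦]⁻ true  F            h         = inj₁ h
not∈ˡ-[↦]⁻ false T            h         = inj₁ h
not∈ˡ-[↦]⁻ false F            h         = inj₂ h

∈ˡ-or-not∈ˡ : ∀ b (X : Tree A) → b ∈ˡ X ⊎ not b ∈ˡ X
∈ˡ-or-not∈ˡ b     (node X a Y) = map left left (∈ˡ-or-not∈ˡ b X)
∈ˡ-or-not∈ˡ true  T            = inj₁ T-leaf
∈ˡ-or-not∈ˡ true  F            = inj₂ F-leaf
∈ˡ-or-not∈ˡ false T            = inj₂ T-leaf
∈ˡ-or-not∈ˡ false F            = inj₁ F-leaf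

not∉ˡ⇒∈ˡ : ∀ b (X : Tree A) → not b ∉ˡ X → b ∈ˡ X
not∉ˡ⇒∈ˡ b X not∉ = [ id , ⊥-elim ∘ not∉ ]′ (∈ˡ-or-not∈ˡ b X)

_∈ˡ?_ : ∀ b (X : Tree A) → Dec (b ∈ˡ X)
b     ∈ˡ? node X a Y with b ∈ˡ? X | b ∈ˡ? Y
... | yes ∈X | _      = yes (left ∈X)
... | no  _  | yes ∈Y = yes (right ∈Y)
... | no ∉X  | no ∉Y  = no λ { (left ∈X) → ∉X ∈X ; (right ∈Y) → ∉Y ∈Y }
true  ∈ˡ? T = yes T-leaf
true  ∈ˡ? F = no λ ()
false ∈ˡ? T = no λ ()
false ∈ˡ? F = yes F-leaf

size-[↦] : b ∈ˡ X → size Z ≤ size (X [ b ↦ Z ])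
size-[↦] T-leaf                        = ≤-refl
size-[↦] F-leaf                        = ≤-refl
size-[↦] {X = node X a Y} (left ∈X)    = ≤-trans (size-[↦] ∈X) (≤-trans (m≤m+n _ _) (n≤1+n _))
size-[↦] {X = node X a Y} (right ∈Y)   = ≤-trans (size-[↦] ∈Y) (≤-trans (m≤n+m _ (size (X [ _ ↦ _ ]))) (n≤1+n _))

size-node[↦] : ∀ {a : A} → b ∈ˡ node X a Y → size Z < size (node X a Y [ b ↦ Z ])
size-node[↦]               (left ∈X)  = s≤s (≤-trans (size-[↦] ∈X) (m≤m+n _ _))
size-node[↦] {X = X}       (right ∈Y) = s≤s (≤-trans (size-[↦] ∈Y) (m≤n+m _ (size (X [ _ ↦ _ ]))))

[↦]-acyclic : ∀ b {X : Tree A} {a Y} → b ∈ˡ Z → Z ≢ node X a Y [ b ↦ Z ]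
[↦]-acyclic b {X = X} {a} {Y} ∈Z e with b ∈ˡ? node X a Y
... | yes ∈XaY = <-irrefl (cong size e) (size-node[↦] ∈XaY)
... | no  ∉XaY = ∉XaY (≡-subst (b ∈ˡ_) (trans e ([↦]-free b _ ∉XaY)) ∈Z)

[↦]-cancelʳ : ∀ b → b ∈ˡ Z → ∀ (W₁ W₂ : Tree A) → W₁ [ b ↦ Z ] ≡ W₂ [ b ↦ Z ] → W₁ ≡ W₂
[↦]-cancelʳ b ∈Z (node X a Y) (node X′ a′ Y′) e with node-injective e
... | eX , refl , eY = cong₂ (λ l r → node l a r) ([↦]-cancelʳ b ∈Z X X′ eX) ([↦]-cancelʳ b ∈Z Y Y′ eY)
[↦]-cancelʳ true  ∈Z T            T            e = refl
[↦]-cancelʳ true  ∈Z T            F            e with ≡-subst (true ∈ˡ_) e ∈Z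
... | ()
[↦]-cancelʳ true  ∈Z T            (node X a Y) e = ⊥-elim ([↦]-acyclic true ∈Z e)
[↦]-cancelʳ true  ∈Z F            T            e with ≡-subst (true ∈ˡ_) (sym e) ∈Z
... | ()
[↦]-cancelʳ true  ∈Z F            F            e = refl
[↦]-cancelʳ true  ∈Z (node X a Y) T            e = ⊥-elim ([↦]-acyclic true ∈Z (sym e))
[↦]-cancelʳ false ∈Z F            F            e = refl
[↦]-cancelʳ false ∈Z F            T            e with ≡-subst (false ∈ˡ_) e ∈Z
... | ()
[↦]-cancelʳ false ∈Z F            (node X a Y) e = ⊥-elim ([↦]-acyclic false ∈Z e)
[↦]-cancelʳ false ∈Z T            F            e with ≡-subst (false ∈ˡ_) (sym e) ∈Z
... | ()
[↦]-cancelʳ false ∈Z T            T            e = refl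
[↦]-cancelʳ false ∈Z (node X a Y) F            e = ⊥-elim ([↦]-acyclic false ∈Z (sym e))

leaf≡[↦] : ∀ b (W₁ W₂ : Tree A) → leaf b ≡ W₁ [ b ↦ W₂ ] → W₁ ≡ leaf b × W₂ ≡ leaf b
leaf≡[↦] true  T W₂ e = refl , sym e
leaf≡[↦] false F W₂ e = refl , sym e

[↦]-mutual : ∀ b {Z Z′ W₁ W₂ : Tree A} → b ∈ˡ Z → Z ≡ W₁ [ b ↦ Z′ ] → Z′ ≡ W₂ [ b ↦ Z ] →
             W₁ ≡ leaf b × W₂ ≡ leaf b
[↦]-mutual b {W₁ = W₁} {W₂} ∈Z Z≡ Z′≡ =
  leaf≡[↦] b W₁ W₂ ([↦]-cancelʳ b ∈Z (leaf b) (W₁ [ b ↦ W₂ ])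
    (trans (leaf[↦] b) (trans Z≡ (trans (cong (W₁ [ b ↦_]) Z′≡) (sym ([↦]-assoc b W₁))))))

Extends : Bool → (Y Z Y′ Z′ : Tree A) → Set
Extends {A} b Y Z Y′ Z′ = Σ (Tree A) λ W → Y′ ≡ Y [ b ↦ W ] × Z ≡ W [ b ↦ Z′ ]

Comparable : Bool → (Y Z Y′ Z′ : Tree A) → Set
Comparable b Y Z Y′ Z′ = Extends b Y Z Y′ Z′ ⊎ Extends b Y′ Z′ Y Z

ComparableOrFree : Bool → (Y Z Y′ Z′ : Tree A) → Set
ComparableOrFree b Y Z Y′ Z′ = Comparable b Y Z Y′ Z′ ⊎ (Y′ ≡ Y × b ∉ˡ Y)

comparable-node : ∀ {a : A} → b ∈ˡ Z → b ∈ˡ Z′ → b ∈ˡ node Y₁ a Y₂ →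
                  ComparableOrFree b Y₁ Z Y₁′ Z′ → ComparableOrFree b Y₂ Z Y₂′ Z′ →
                  Comparable b (node Y₁ a Y₂) Z (node Y₁′ a Y₂′) Z′
comparable-node ∈Z ∈Z′ (left ∈Y₁)  (inj₂ (_ , ∉Y₁)) (inj₂ _)           = ⊥-elim (∉Y₁ ∈Y₁)
comparable-node ∈Z ∈Z′ (right ∈Y₂) (inj₂ _)           (inj₂ (_ , ∉Y₂)) = ⊥-elim (∉Y₂ ∈Y₂)
comparable-node {b = b} {Y₂ = Y₂} ∈Z ∈Z′ ∈Y (inj₁ (inj₁ (W , p , q))) (inj₂ (refl , ∉Y₂)) =
  inj₁ (W , cong₂ (λ l r → node l _ r) p (sym ([↦]-free b Y₂ ∉Y₂)) , q)
comparable-node {b = b} {Y₂ = Y₂} ∈Z ∈Z′ ∈Y (inj₁ (inj₂ (W , p , q))) (inj₂ (refl , ∉Y₂)) =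
  inj₂ (W , cong₂ (λ l r → node l _ r) p (sym ([↦]-free b Y₂ ∉Y₂)) , q)
comparable-node {b = b} {Y₁ = Y₁} ∈Z ∈Z′ ∈Y (inj₂ (refl , ∉Y₁)) (inj₁ (inj₁ (W , p , q))) =
  inj₁ (W , cong₂ (λ l r → node l _ r) (sym ([↦]-free b Y₁ ∉Y₁)) p , q)
comparable-node {b = b} {Y₁ = Y₁} ∈Z ∈Z′ ∈Y (inj₂ (refl , ∉Y₁)) (inj₁ (inj₂ (W , p , q))) =
  inj₂ (W , cong₂ (λ l r → node l _ r) (sym ([↦]-free b Y₁ ∉Y₁)) p , q)
comparable-node {b = b} ∈Z ∈Z′ ∈Y (inj₁ (inj₁ (W₁ , p₁ , q₁))) (inj₁ (inj₁ (W₂ , p₂ , q₂)))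
  with [↦]-cancelʳ b ∈Z′ W₁ W₂ (trans (sym q₁) q₂)
... | refl = inj₁ (W₁ , cong₂ (λ l r → node l _ r) p₁ p₂ , q₁)
comparable-node {b = b} ∈Z ∈Z′ ∈Y (inj₁ (inj₂ (W₁ , p₁ , q₁))) (inj₁ (inj₂ (W₂ , p₂ , q₂)))
  with [↦]-cancelʳ b ∈Z W₁ W₂ (trans (sym q₁) q₂)
... | refl = inj₂ (W₁ , cong₂ (λ l r → node l _ r) p₁ p₂ , q₁)
comparable-node {b = b} {Y₂ = Y₂} {Y₂′ = Y₂′} ∈Z ∈Z′ ∈Y (inj₁ (inj₁ (W₁ , p₁ , q₁))) (inj₁ (inj₂ (W₂ , p₂ , q₂)))
  with [↦]-mutual b {W₁ = W₁} {W₂} ∈Z q₁ q₂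
... | refl , refl =
  inj₁ (leaf b , cong₂ (λ l r → node l _ r) p₁ (trans (sym (trans p₂ ([↦leaf] b Y₂′))) (sym ([↦leaf] b Y₂))) , q₁)
comparable-node {b = b} {Y₁ = Y₁} {Y₁′ = Y₁′} ∈Z ∈Z′ ∈Y (inj₁ (inj₂ (W₁ , p₁ , q₁))) (inj₁ (inj₁ (W₂ , p₂ , q₂)))
  with [↦]-mutual b {W₁ = W₂} {W₁} ∈Z q₂ q₁
... | refl , refl =
  inj₁ (leaf b , cong₂ (λ l r → node l _ r) (trans (sym (trans p₁ ([↦leaf] b Y₁′))) (sym ([↦leaf] b Y₁))) p₂ , q₂)

-- The analogue of Levi's lemma for words.
mutual
  comparable : ∀ b (Y Z Y′ Z′ : Tree A) → Y [ b ↦ Z ] ≡ Y′ [ b ↦ Z′ ] →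
               b ∈ˡ Z → b ∈ˡ Z′ → b ∈ˡ Y → b ∈ˡ Y′ → Comparable b Y Z Y′ Z′
  comparable b (node Y₁ a Y₂) Z (node Y₁′ a′ Y₂′) Z′ e ∈Z ∈Z′ ∈Y ∈Y′ with node-injective e
  ... | e₁ , refl , e₂ = comparable-node ∈Z ∈Z′ ∈Y (comparable-or-free b Y₁ Z Y₁′ Z′ e₁ ∈Z ∈Z′)
                                                     (comparable-or-free b Y₂ Z Y₂′ Z′ e₂ ∈Z ∈Z′)
  comparable true  T              Z Y′ Z′ e ∈Z ∈Z′ ∈Y ∈Y′ = inj₁ (Y′ , refl , e)
  comparable false F              Z Y′ Z′ e ∈Z ∈Z′ ∈Y ∈Y′ = inj₁ (Y′ , refl , e)
  comparable true  (node Y₁ a Y₂) Z T  Z′ e ∈Z ∈Z′ ∈Y ∈Y′ = inj₂ (node Y₁ a Y₂ , refl , sym e)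
  comparable false (node Y₁ a Y₂) Z F  Z′ e ∈Z ∈Z′ ∈Y ∈Y′ = inj₂ (node Y₁ a Y₂ , refl , sym e)

  comparable-or-free : ∀ b (Y Z Y′ Z′ : Tree A) → Y [ b ↦ Z ] ≡ Y′ [ b ↦ Z′ ] →
                       b ∈ˡ Z → b ∈ˡ Z′ → ComparableOrFree b Y Z Y′ Z′
  comparable-or-free b Y Z Y′ Z′ e ∈Z ∈Z′ with b ∈ˡ? Y | b ∈ˡ? Y′
  ... | yes ∈Y | yes ∈Y′ = inj₁ (comparable b Y Z Y′ Z′ e ∈Z ∈Z′ ∈Y ∈Y′)
  ... | no ∉Y  | no ∉Y′  = inj₂ (trans (sym ([↦]-free b Y′ ∉Y′)) (trans (sym e) ([↦]-free b Y ∉Y)) , ∉Y)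
  ... | yes ∈Y | no ∉Y′  = ⊥-elim (∉Y′ (≡-subst (b ∈ˡ_) (trans e ([↦]-free b Y′ ∉Y′)) (∈ˡ-[↦] ∈Y ∈Z)))
  ... | no ∉Y  | yes ∈Y′ = ⊥-elim (∉Y (≡-subst (b ∈ˡ_) (trans (sym e) ([↦]-free b Y ∉Y)) (∈ˡ-[↦] ∈Y′ ∈Z′)))

size-node[↦]≡ : ∀ b {X : Tree A} {a Y} → b ∈ˡ Z′ → node X a Y [ b ↦ Z ] ≡ Z′ → size Z < size Z′
size-node[↦]≡ b {X} {a} {Y} ∈Z′ e with b ∈ˡ? node X a Y
... | yes ∈XaY = ≡-subst (_ <_) (cong size e) (size-node[↦] ∈XaY)
... | no  ∉XaY = ⊥-elim (∉XaY (≡-subst (b ∈ˡ_) (trans (sym e) ([↦]-free b _ ∉XaY)) ∈Z′))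

-- Following a (not b)-leaf of Y, the right-hand side must graft Z′ where the left one
-- still has a node of Y above the grafted Z.
size-<-opposite : ∀ b (Y Z Y′ Z′ : Tree A) → Y [ b ↦ Z ] ≡ Y′ [ not b ↦ Z′ ] →
                  not b ∈ˡ Y → b ∈ˡ Z′ → size Z < size Z′
size-<-opposite b (node Y₁ a Y₂) Z (node Y₁′ a′ Y₂′) Z′ e (left ∈Y₁) ∈Z′ =
  size-<-opposite b Y₁ Z Y₁′ Z′ (proj₁ (node-injective e)) ∈Y₁ ∈Z′
size-<-opposite b (node Y₁ a Y₂) Z (node Y₁′ a′ Y₂′) Z′ e (right ∈Y₂) ∈Z′ =
  size-<-opposite b Y₂ Z Y₂′ Z′ (proj₂ (proj₂ (node-injective e))) ∈Y₂ ∈Z′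
size-<-opposite true  (node Y₁ a Y₂) Z F Z′ e ∈Y ∈Z′ = size-node[↦]≡ true ∈Z′ e
size-<-opposite false (node Y₁ a Y₂) Z T Z′ e ∈Y ∈Z′ = size-node[↦]≡ false ∈Z′ e
size-<-opposite true  F Z F Z′ e ∈Y ∈Z′ with ≡-subst (true ∈ˡ_) (sym e) ∈Z′
... | ()
size-<-opposite false T Z T Z′ e ∈Y ∈Z′ with ≡-subst (false ∈ˡ_) (sym e) ∈Z′
... | ()

size-<-opposite′ : ∀ b (Y Z Y′ Z′ : Tree A) → Y [ not b ↦ Z ] ≡ Y′ [ b ↦ Z′ ] →
                   b ∈ˡ Y → not b ∈ˡ Z′ → size Z < size Z′
size-<-opposite′ b Y Z Y′ Z′ e ∈Y ∈Z′ = size-<-opposite (not b) Y Z Y′ Z′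
  (≡-subst (λ c → Y [ not b ↦ Z ] ≡ Y′ [ c ↦ Z′ ]) (sym (not-involutive b)) e)
  (≡-subst (_∈ˡ Y) (sym (not-involutive b)) ∈Y) ∈Z′

-- Z′ is too small to cover a node of W, so all of W survives in Y′.
pure-prefix-factor : ∀ b (W K Y′ Z′ : Tree A) → W [ b ↦ K ] ≡ Y′ [ not b ↦ Z′ ] →
                     not b ∉ˡ W → size Z′ < size K → not b ∈ˡ Z′ →
                     Σ (Tree A) λ K′ → Y′ ≡ W [ b ↦ K′ ] × K ≡ K′ [ not b ↦ Z′ ]
pure-prefix-factor b (node W₁ a W₂) K (node Y₁ a′ Y₂) Z′ e ∉W Z′<K ∈Z′ with node-injective e
... | e₁ , refl , e₂
  with pure-prefix-factor b W₁ K Y₁ Z′ e₁ (∉W ∘ left) Z′<K ∈Z′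
     | pure-prefix-factor b W₂ K Y₂ Z′ e₂ (∉W ∘ right) Z′<K ∈Z′
... | K₁ , p₁ , q₁ | K₂ , p₂ , q₂ with [↦]-cancelʳ (not b) ∈Z′ K₁ K₂ (trans (sym q₁) q₂)
... | refl = K₁ , cong₂ (λ l r → node l a r) p₁ p₂ , q₁
pure-prefix-factor true  (node W₁ a W₂) K F Z′ e ∉W Z′<K ∈Z′ =
  ⊥-elim (<-asym Z′<K (≡-subst (_ <_) (cong size e) (size-node[↦] (not∉ˡ⇒∈ˡ true _ ∉W))))
pure-prefix-factor false (node W₁ a W₂) K T Z′ e ∉W Z′<K ∈Z′ =
  ⊥-elim (<-asym Z′<K (≡-subst (_ <_) (cong size e) (size-node[↦] (not∉ˡ⇒∈ˡ false _ ∉W))))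
pure-prefix-factor true  T K Y′ Z′ e ∉W Z′<K ∈Z′ = Y′ , refl , e
pure-prefix-factor false F K Y′ Z′ e ∉W Z′<K ∈Z′ = Y′ , refl , e
pure-prefix-factor true  F K Y′ Z′ e ∉W Z′<K ∈Z′ = ⊥-elim (∉W F-leaf)
pure-prefix-factor false T K Y′ Z′ e ∉W Z′<K ∈Z′ = ⊥-elim (∉W T-leaf)

uniform : Bool → Tree A → Tree A
uniform b (node X a Y) = node (uniform b X) a (uniform b Y)
uniform b T            = leaf b
uniform b F            = leaf b

∈ˡ-uniform : ∀ b (U : Tree A) → b ∈ˡ uniform b U
∈ˡ-uniform b     (node X a Y) = left (∈ˡ-uniform b X)
∈ˡ-uniform true  T            = T-leaf
∈ˡ-uniform true  F            = T-leaf
∈ˡ-uniform false T            = F-leaf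
∈ˡ-uniform false F            = F-leaf

∈ˡ-uniform⁻ : ∀ b (U : Tree A) → c ∈ˡ uniform b U → c ≡ b
∈ˡ-uniform⁻ b     (node X a Y) (left ∈X)  = ∈ˡ-uniform⁻ b X ∈X
∈ˡ-uniform⁻ b     (node X a Y) (right ∈Y) = ∈ˡ-uniform⁻ b Y ∈Y
∈ˡ-uniform⁻ true  T            T-leaf     = refl
∈ˡ-uniform⁻ true  F            T-leaf     = refl
∈ˡ-uniform⁻ false T            F-leaf     = refl
∈ˡ-uniform⁻ false F            F-leaf     = refl

not∉ˡ-uniform : ∀ b (U : Tree A) → not b ∉ˡ uniform b U
not∉ˡ-uniform b U ∈U = not-¬ refl (sym (∈ˡ-uniform⁻ b U ∈U))

∉ˡ-uniform-not : ∀ b (U : Tree A) → b ∉ˡ uniform (not b) U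
∉ˡ-uniform-not b U ∈U = not-¬ refl (∈ˡ-uniform⁻ (not b) U ∈U)

T-term-uniform : ∀ b (U : Tree A) → T-term (uniform b U) ≡ T-term U
T-term-uniform b     (node X a Y) = cong₂ (λ l r → (atom a ∧' l) ∨' r) (T-term-uniform b X) (T-term-uniform b Y)
T-term-uniform true  T            = refl
T-term-uniform true  F            = refl
T-term-uniform false T            = refl
T-term-uniform false F            = refl

F-term-uniform : ∀ b (U : Tree A) → F-term (uniform b U) ≡ F-term U
F-term-uniform b     (node X a Y) = cong₂ (λ l r → (atom a ∨' r) ∧' l) (F-term-uniform b X) (F-term-uniform b Y)
F-term-uniform true  T            = refl
F-term-uniform true  F            = refl
F-term-uniform false T            = refl
F-term-uniform false F            = refl

T-term-cong : ∀ b (U U′ : Tree A) → uniform b U ≡ uniform b U′ → T-term U ≡ T-term U′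
T-term-cong b U U′ e = trans (sym (T-term-uniform b U)) (trans (cong T-term e) (T-term-uniform b U′))

F-term-cong : ∀ b (U U′ : Tree A) → uniform b U ≡ uniform b U′ → F-term U ≡ F-term U′
F-term-cong b U U′ e = trans (sym (F-term-uniform b U)) (trans (cong F-term e) (F-term-uniform b U′))

uniform-true≢uniform-false : ∀ (U U′ : Tree A) → uniform true U ≢ uniform false U′
uniform-true≢uniform-false U U′ e = not∉ˡ-uniform false U′ (≡-subst (true ∈ˡ_) e (∈ˡ-uniform true U))

orT-uniform-true : ∀ (X : Tree A) → orT (uniform true X) W ≡ uniform true X
orT-uniform-true (node X a Y) = cong₂ (λ l r → node l a r) (orT-uniform-true X) (orT-uniform-true Y)
orT-uniform-true T            = refl
orT-uniform-true F            = refl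

andT-uniform-false : ∀ (X : Tree A) → andT (uniform false X) W ≡ uniform false X
andT-uniform-false (node X a Y) = cong₂ (λ l r → node l a r) (andT-uniform-false X) (andT-uniform-false Y)
andT-uniform-false T            = refl
andT-uniform-false F            = refl

se-T-term : ∀ (U : Tree A) → se (T-term U) ≡ uniform true U
se-T-term T            = refl
se-T-term F            = refl
se-T-term (node X a Y) = cong₂ (λ l r → node l a r)
  (trans (cong₂ orT (se-T-term X) (se-T-term Y)) (orT-uniform-true X)) (se-T-term Y)

se-F-term : ∀ (U : Tree A) → se (F-term U) ≡ uniform false U
se-F-term T            = refl
se-F-term F            = refl
se-F-term (node X a Y) = cong₂ (λ l r → node l a r) (se-F-term X)
  (trans (cong₂ andT (se-F-term Y) (se-F-term X)) (andT-uniform-false Y))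

treeᴹ : Mixed A → Tree A
treeᴹ (lit true  a U V) = node (uniform true U) a (uniform false V)
treeᴹ (lit false a U V) = node (uniform false V) a (uniform true U)
treeᴹ (op b M N)        = treeᴹ M [ b ↦ treeᴹ N ]

se-⌜⌝ᴹ : ∀ (M : Mixed A) → se ⌜ M ⌝ᴹ ≡ treeᴹ M
se-⌜⌝ᴹ (lit true  a U V) = cong₂ (λ l r → node l a r)
  (trans (cong₂ orT (se-T-term U) (se-F-term V)) (orT-uniform-true U)) (se-F-term V)
se-⌜⌝ᴹ (lit false a U V) = cong₂ (λ l r → node l a r) (se-F-term V)
  (trans (cong₂ orT (se-T-term U) (se-F-term V)) (orT-uniform-true U))
se-⌜⌝ᴹ (op true  M N)    = trans (cong₂ andT (se-⌜⌝ᴹ M) (se-⌜⌝ᴹ N)) (sym ([true↦]≡andT (treeᴹ M)))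
se-⌜⌝ᴹ (op false M N)    = trans (cong₂ orT (se-⌜⌝ᴹ M) (se-⌜⌝ᴹ N)) (sym ([false↦]≡orT (treeᴹ M)))

∈ˡ-treeᴹ : ∀ (M : Mixed A) b → b ∈ˡ treeᴹ M
∈ˡ-treeᴹ (lit true  a U V) true  = left (∈ˡ-uniform true U)
∈ˡ-treeᴹ (lit true  a U V) false = right (∈ˡ-uniform false V)
∈ˡ-treeᴹ (lit false a U V) true  = right (∈ˡ-uniform true U)
∈ˡ-treeᴹ (lit false a U V) false = left (∈ˡ-uniform false V)
∈ˡ-treeᴹ (op true  M N)    true  = ∈ˡ-[↦] (∈ˡ-treeᴹ M true) (∈ˡ-treeᴹ N true)
∈ˡ-treeᴹ (op false M N)    false = ∈ˡ-[↦] (∈ˡ-treeᴹ M false) (∈ˡ-treeᴹ N false)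
∈ˡ-treeᴹ (op true  M N)    false = not∈ˡ-[↦] true (treeᴹ M) (∈ˡ-treeᴹ M false)
∈ˡ-treeᴹ (op false M N)    true  = not∈ˡ-[↦] false (treeᴹ M) (∈ˡ-treeᴹ M true)

not∈ˡ-[↦]ʳ : ∀ b (Y : Tree A) → not b ∈ˡ Z → not b ∈ˡ Y [ b ↦ Z ]
not∈ˡ-[↦]ʳ b Y ∈Z = [ (λ ∈Y → ∈ˡ-[↦] ∈Y ∈Z) , not∈ˡ-[↦] b Y ]′ (∈ˡ-or-not∈ˡ b Y)

uniform≡[↦]⇒not∉ˡ : ∀ b (U Y : Tree A) → uniform b U ≡ Y [ b ↦ Z ] → not b ∉ˡ Z
uniform≡[↦]⇒not∉ˡ b U Y e ∈Z = not∉ˡ-uniform b U (≡-subst (not b ∈ˡ_) (sym e) (not∈ˡ-[↦]ʳ b Y ∈Z))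

uniform-not≡pure[↦]⇒∉ˡ : ∀ b (U W : Tree A) → uniform (not b) U ≡ W [ b ↦ K ] → not b ∉ˡ W → b ∉ˡ K
uniform-not≡pure[↦]⇒∉ˡ b U W e ∉W ∈K =
  ∉ˡ-uniform-not b U (≡-subst (b ∈ˡ_) (sym e) (∈ˡ-[↦] (not∉ˡ⇒∈ˡ b W ∉W) ∈K))

Indecomposable : Bool → Tree A → Set
Indecomposable {A} b X = ∀ {Y W : Tree A} → X ≡ Y [ b ↦ W ] → b ∈ˡ Y → not b ∈ˡ Y → not b ∉ˡ W

lit-indecomposable : ∀ b p (a : A) U V → Indecomposable b (treeᴹ (lit p a U V))
lit-indecomposable true  true  a U V {node Y₁ _ _} e _ _ = uniform≡[↦]⇒not∉ˡ true U Y₁ (proj₁ (node-injective e))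
lit-indecomposable false true  a U V {node _ _ Y₂} e _ _ = uniform≡[↦]⇒not∉ˡ false V Y₂ (proj₂ (proj₂ (node-injective e)))
lit-indecomposable true  false a U V {node _ _ Y₂} e _ _ = uniform≡[↦]⇒not∉ˡ true U Y₂ (proj₂ (proj₂ (node-injective e)))
lit-indecomposable false false a U V {node Y₁ _ _} e _ _ = uniform≡[↦]⇒not∉ˡ false V Y₁ (proj₁ (node-injective e))

-- Each graft would have to be strictly smaller than the other one.
[↦]≢[not↦] : ∀ b (Y Z Y′ Z′ : Tree A) → Y [ b ↦ Z ] ≡ Y′ [ not b ↦ Z′ ] →
             not b ∈ˡ Y → b ∈ˡ Z′ → b ∈ˡ Y′ → not b ∈ˡ Z → ⊥
[↦]≢[not↦] b Y Z Y′ Z′ e ∈Y ∈Z′ ∈Y′ ∈Z =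
  <-asym (size-<-opposite b Y Z Y′ Z′ e ∈Y ∈Z′) (size-<-opposite′ b Y′ Z′ Y Z (sym e) ∈Y′ ∈Z)

NotOp⇒indecomposable : ∀ b (M : Mixed A) → NotOp b M → Indecomposable b (treeᴹ M)
NotOp⇒indecomposable b (lit p a U V)         _    = lit-indecomposable b p a U V
NotOp⇒indecomposable b (op .(not b) M₁ M₂) refl {Y} {W} e ∈Y ∈′Y ∈′W =
  [↦]≢[not↦] b Y W (treeᴹ M₁) (treeᴹ M₂) (sym e) ∈′Y (∈ˡ-treeᴹ M₂ b) (∈ˡ-treeᴹ M₁ b) ∈′W

NoPrefix : Bool → Tree A → Tree A → Set
NoPrefix {A} b W X = ∀ {K : Tree A} → b ∈ˡ K → not b ∈ˡ K → X ≢ W [ b ↦ K ]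

[↦]-noPrefix : ∀ b (M₁ M₂ : Mixed A) → not b ∉ˡ W → b ∈ˡ W →
               NoPrefix b W (treeᴹ M₁) → NoPrefix b W (treeᴹ M₁ [ b ↦ treeᴹ M₂ ])
[↦]-noPrefix {W = W} b M₁ M₂ ∉W ∈W noPrefix₁ {K} ∈K ∈′K e
  with comparable b (treeᴹ M₁) (treeᴹ M₂) W K e (∈ˡ-treeᴹ M₂ b) ∈K (∈ˡ-treeᴹ M₁ b) ∈W
... | inj₁ (_ , p , _) = ∉W (≡-subst (not b ∈ˡ_) (sym p) (not∈ˡ-[↦] b _ (∈ˡ-treeᴹ M₁ (not b))))
... | inj₂ (W′ , p , q) with not∈ˡ-[↦]⁻ b W (≡-subst (not b ∈ˡ_) p (∈ˡ-treeᴹ M₁ (not b)))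
...   | inj₁ ∈′W = ∉W ∈′W
...   | inj₂ ∈′W′ with b ∈ˡ? W′
...     | yes ∈W′ = noPrefix₁ ∈W′ ∈′W′ p
...     | no ∉W′  = ∉W′ (≡-subst (b ∈ˡ_) (trans q ([↦]-free b W′ ∉W′)) ∈K)

[not↦]-noPrefix : ∀ b (M₁ M₂ : Mixed A) → not b ∉ˡ W →
                  NoPrefix b W (treeᴹ M₁) → NoPrefix b W (treeᴹ M₁ [ not b ↦ treeᴹ M₂ ])
[not↦]-noPrefix {W = W} b M₁ M₂ ∉W noPrefix₁ {K} ∈K ∈′K e
  with pure-prefix-factor b W K (treeᴹ M₁) (treeᴹ M₂) (sym e) ∉W
         (size-<-opposite′ b (treeᴹ M₁) (treeᴹ M₂) W K e (∈ˡ-treeᴹ M₁ b) ∈′K) (∈ˡ-treeᴹ M₂ (not b))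
... | K′ , p , q with not b ∈ˡ? K′
...   | yes ∈′K′ = noPrefix₁ (∈ˡ-[↦]⁻ b W (≡-subst (b ∈ˡ_) p (∈ˡ-treeᴹ M₁ b))) ∈′K′ p
...   | no ∉′K′  = ∉′K′ (≡-subst (not b ∈ˡ_) (trans q ([↦]-free (not b) K′ ∉′K′)) ∈′K)

treeᴹ-noPrefix : ∀ b (M : Mixed A) {W₁ c W₂} → not b ∉ˡ node W₁ c W₂ → NoPrefix b (node W₁ c W₂) (treeᴹ M)
treeᴹ-noPrefix true  (lit true  a U V) ∉W ∈K _ e =
  uniform-not≡pure[↦]⇒∉ˡ true V _ (proj₂ (proj₂ (node-injective e))) (∉W ∘ right) ∈K
treeᴹ-noPrefix false (lit true  a U V) ∉W ∈K _ e =
  uniform-not≡pure[↦]⇒∉ˡ false U _ (proj₁ (node-injective e)) (∉W ∘ left) ∈K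
treeᴹ-noPrefix true  (lit false a U V) ∉W ∈K _ e =
  uniform-not≡pure[↦]⇒∉ˡ true V _ (proj₁ (node-injective e)) (∉W ∘ left) ∈K
treeᴹ-noPrefix false (lit false a U V) ∉W ∈K _ e =
  uniform-not≡pure[↦]⇒∉ˡ false U _ (proj₂ (proj₂ (node-injective e))) (∉W ∘ right) ∈K
treeᴹ-noPrefix true  (op true  M₁ M₂) ∉W =
  [↦]-noPrefix true M₁ M₂ ∉W (not∉ˡ⇒∈ˡ true _ ∉W) (treeᴹ-noPrefix true M₁ ∉W)
treeᴹ-noPrefix false (op false M₁ M₂) ∉W =
  [↦]-noPrefix false M₁ M₂ ∉W (not∉ˡ⇒∈ˡ false _ ∉W) (treeᴹ-noPrefix false M₁ ∉W)
treeᴹ-noPrefix true  (op false M₁ M₂) ∉W = [not↦]-noPrefix true M₁ M₂ ∉W (treeᴹ-noPrefix true M₁ ∉W)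
treeᴹ-noPrefix false (op true  M₁ M₂) ∉W = [not↦]-noPrefix false M₁ M₂ ∉W (treeᴹ-noPrefix false M₁ ∉W)

pure-prefix-trivial : ∀ b (W : Tree A) (M M′ : Mixed A) → not b ∉ˡ W →
                      treeᴹ M ≡ W [ b ↦ treeᴹ M′ ] → W ≡ leaf b
pure-prefix-trivial b     (node W₁ c W₂) M M′ ∉W e =
  ⊥-elim (treeᴹ-noPrefix b M ∉W (∈ˡ-treeᴹ M′ b) (∈ˡ-treeᴹ M′ (not b)) e)
pure-prefix-trivial true  T              M M′ ∉W e = refl
pure-prefix-trivial false F              M M′ ∉W e = refl
pure-prefix-trivial true  F              M M′ ∉W e = ⊥-elim (∉W F-leaf)
pure-prefix-trivial false T              M M′ ∉W e = ⊥-elim (∉W T-leaf)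

extension-trivial : ∀ b (M₁ M₂ M₁′ M₂′ : Mixed A) → NotOp b M₁′ →
                    Extends b (treeᴹ M₁) (treeᴹ M₂) (treeᴹ M₁′) (treeᴹ M₂′) →
                    treeᴹ M₁ ≡ treeᴹ M₁′ × treeᴹ M₂ ≡ treeᴹ M₂′
extension-trivial b M₁ M₂ M₁′ M₂′ notOp (W , p , q)
  with pure-prefix-trivial b W M₂ M₂′
         (NotOp⇒indecomposable b M₁′ notOp p (∈ˡ-treeᴹ M₁ b) (∈ˡ-treeᴹ M₁ (not b))) q
... | refl = sym (trans p ([↦leaf] b _)) , trans q (leaf[↦] b)

mutual
  treeᴹ-injective : ∀ {M M′ : Mixed A} → Canonical M → Canonical M′ → treeᴹ M ≡ treeᴹ M′ → ⌜ M ⌝ᴹ ≡ ⌜ M′ ⌝ᴹ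
  treeᴹ-injective {M = lit true a U V} {lit true a′ U′ V′} lit lit e with node-injective e
  ... | eU , refl , eV =
    cong₂ (λ l r → (atom a ∧' l) ∨' r) (T-term-cong true U U′ eU) (F-term-cong false V V′ eV)
  treeᴹ-injective {M = lit false a U V} {lit false a′ U′ V′} lit lit e with node-injective e
  ... | eV , refl , eU =
    cong₂ (λ l r → (¬' atom a ∧' l) ∨' r) (T-term-cong true U U′ eU) (F-term-cong false V V′ eV)
  treeᴹ-injective {M = lit true a U V} {lit false a′ U′ V′} lit lit e =
    ⊥-elim (uniform-true≢uniform-false U V′ (proj₁ (node-injective e)))
  treeᴹ-injective {M = lit false a U V} {lit true a′ U′ V′} lit lit e =
    ⊥-elim (uniform-true≢uniform-false U′ V (sym (proj₁ (node-injective e))))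
  treeᴹ-injective {M = lit p a U V} {op b M₁ M₂} lit (op _ _ _) e =
    ⊥-elim (lit-indecomposable b p a U V e (∈ˡ-treeᴹ M₁ b) (∈ˡ-treeᴹ M₁ (not b)) (∈ˡ-treeᴹ M₂ (not b)))
  treeᴹ-injective {M = op b M₁ M₂} {lit p a U V} (op _ _ _) lit e =
    ⊥-elim (lit-indecomposable b p a U V (sym e) (∈ˡ-treeᴹ M₁ b) (∈ˡ-treeᴹ M₁ (not b)) (∈ˡ-treeᴹ M₂ (not b)))
  treeᴹ-injective {M = op true M₁ M₂} {op false M₁′ M₂′} (op _ _ _) (op _ _ _) e =
    ⊥-elim ([↦]≢[not↦] true _ _ _ _ e
      (∈ˡ-treeᴹ M₁ false) (∈ˡ-treeᴹ M₂′ true) (∈ˡ-treeᴹ M₁′ true) (∈ˡ-treeᴹ M₂ false))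
  treeᴹ-injective {M = op false M₁ M₂} {op true M₁′ M₂′} (op _ _ _) (op _ _ _) e =
    ⊥-elim ([↦]≢[not↦] false _ _ _ _ e
      (∈ˡ-treeᴹ M₁ true) (∈ˡ-treeᴹ M₂′ false) (∈ˡ-treeᴹ M₁′ false) (∈ˡ-treeᴹ M₂ true))
  treeᴹ-injective {M = op true  _ _} {op true  _ _} (op o c₁ c₂) (op o′ c₁′ c₂′) e =
    op-injective true  o o′ c₁ c₂ c₁′ c₂′ e
  treeᴹ-injective {M = op false _ _} {op false _ _} (op o c₁ c₂) (op o′ c₁′ c₂′) e =
    op-injective false o o′ c₁ c₂ c₁′ c₂′ e

  op-injective : ∀ b {M₁ M₂ M₁′ M₂′ : Mixed A} → NotOp b M₁ → NotOp b M₁′ →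
                 Canonical M₁ → Canonical M₂ → Canonical M₁′ → Canonical M₂′ →
                 treeᴹ M₁ [ b ↦ treeᴹ M₂ ] ≡ treeᴹ M₁′ [ b ↦ treeᴹ M₂′ ] → ⌜ op b M₁ M₂ ⌝ᴹ ≡ ⌜ op b M₁′ M₂′ ⌝ᴹ
  op-injective b {M₁} {M₂} {M₁′} {M₂′} o o′ c₁ c₂ c₁′ c₂′ e
    with comparable b _ _ _ _ e (∈ˡ-treeᴹ M₂ b) (∈ˡ-treeᴹ M₂′ b) (∈ˡ-treeᴹ M₁ b) (∈ˡ-treeᴹ M₁′ b)
  ... | inj₁ ext with extension-trivial b M₁ M₂ M₁′ M₂′ o′ ext
  ...   | e₁ , e₂ = cong₂ (connective b) (treeᴹ-injective c₁ c₁′ e₁) (treeᴹ-injective c₂ c₂′ e₂)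
  op-injective b {M₁} {M₂} {M₁′} {M₂′} o o′ c₁ c₂ c₁′ c₂′ e | inj₂ ext
    with extension-trivial b M₁′ M₂′ M₁ M₂ o ext
  ...   | e₁ , e₂ = cong₂ (connective b) (treeᴹ-injective c₁ c₁′ (sym e₁)) (treeᴹ-injective c₂ c₂′ (sym e₂))

treeᴺ : NF A → Tree A
treeᴺ (T-nf U)   = uniform true U
treeᴺ (F-nf U)   = uniform false U
treeᴺ (M-nf U M) = uniform true U [ true ↦ treeᴹ M ]

se-⌜⌝ : ∀ (n : NF A) → se ⌜ n ⌝ ≡ treeᴺ n
se-⌜⌝ (T-nf U)   = se-T-term U
se-⌜⌝ (F-nf U)   = se-F-term U
se-⌜⌝ (M-nf U M) = trans (cong₂ andT (se-T-term U) (se-⌜⌝ᴹ M)) (sym ([true↦]≡andT (uniform true U)))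

CanonicalNF : NF A → Set
CanonicalNF (M-nf U M) = Canonical M
CanonicalNF _          = ⊤

canonicalNF : ∀ (n : NF A) → Σ (NF A) λ m → CanonicalNF m × A ⊢ ⌜ n ⌝ ≈ ⌜ m ⌝
canonicalNF (T-nf U)   = T-nf U , tt , refl≈
canonicalNF (F-nf U)   = F-nf U , tt , refl≈
canonicalNF (M-nf U M) = let K , cK , M≈K = canonicalise M in M-nf U K , cK , cong∧ refl≈ M≈K

uniform≢M-nf : ∀ c (U U′ : Tree A) (M : Mixed A) → uniform c U ≢ uniform true U′ [ true ↦ treeᴹ M ]
uniform≢M-nf c U U′ M e =
  not∉ˡ-uniform c U (≡-subst (not c ∈ˡ_) (sym e) (∈ˡ-[↦] (∈ˡ-uniform true U′) (∈ˡ-treeᴹ M (not c))))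

T-prefix-trivial : ∀ (U U′ W : Tree A) (M M′ : Mixed A) → uniform true U′ ≡ uniform true U [ true ↦ W ] →
                   treeᴹ M ≡ W [ true ↦ treeᴹ M′ ] → T-term U ≡ T-term U′ × treeᴹ M ≡ treeᴹ M′
T-prefix-trivial U U′ W M M′ p q
  with pure-prefix-trivial true W M M′ (uniform≡[↦]⇒not∉ˡ true U′ (uniform true U) p) q
... | refl = T-term-cong true U U′ (sym (trans p ([↦leaf] true _))) , q

treeᴺ-injective : ∀ (n m : NF A) → CanonicalNF n → CanonicalNF m → treeᴺ n ≡ treeᴺ m → ⌜ n ⌝ ≡ ⌜ m ⌝
treeᴺ-injective (T-nf U)   (T-nf U′)  _ _ e = T-term-cong true U U′ e
treeᴺ-injective (F-nf U)   (F-nf U′)  _ _ e = F-term-cong false U U′ e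
treeᴺ-injective (T-nf U)   (F-nf U′)  _ _ e = ⊥-elim (uniform-true≢uniform-false U U′ e)
treeᴺ-injective (F-nf U)   (T-nf U′)  _ _ e = ⊥-elim (uniform-true≢uniform-false U′ U (sym e))
treeᴺ-injective (T-nf U)    (M-nf U′ M) _ _ e = ⊥-elim (uniform≢M-nf true U U′ M e)
treeᴺ-injective (M-nf U′ M) (T-nf U)    _ _ e = ⊥-elim (uniform≢M-nf true U U′ M (sym e))
treeᴺ-injective (F-nf U)    (M-nf U′ M) _ _ e = ⊥-elim (uniform≢M-nf false U U′ M e)
treeᴺ-injective (M-nf U′ M) (F-nf U)    _ _ e = ⊥-elim (uniform≢M-nf false U U′ M (sym e))
treeᴺ-injective (M-nf U M) (M-nf U′ M′) cM cM′ e
  with comparable true (uniform true U) (treeᴹ M) (uniform true U′) (treeᴹ M′) e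
         (∈ˡ-treeᴹ M true) (∈ˡ-treeᴹ M′ true) (∈ˡ-uniform true U) (∈ˡ-uniform true U′)
... | inj₁ (W , p , q) with T-prefix-trivial U U′ W M M′ p q
...   | eU , eM = cong₂ _∧'_ eU (treeᴹ-injective cM cM′ eM)
treeᴺ-injective (M-nf U M) (M-nf U′ M′) cM cM′ e | inj₂ (W , p , q) with T-prefix-trivial U′ U W M′ M p q
...   | eU , eM = cong₂ _∧'_ (sym eU) (treeᴹ-injective cM cM′ (sym eM))

≡⇒≈ : {P Q : Term A V} → P ≡ Q → A ⊢ P ≈ Q
≡⇒≈ refl = refl≈

canonical-normal-form : ∀ (P : S A) → Σ (NF A) λ n → CanonicalNF n × A ⊢ P ≈ ⌜ n ⌝
canonical-normal-form P =
  let n , P≈n      = normalise P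
      m , cm , n≈m = canonicalNF n
  in m , cm , trans≈ P≈n n≈m

se-complete : ∀ (P Q : S A) → se P ≡ se Q → A ⊢ P ≈ Q
se-complete P Q e with canonical-normal-form P | canonical-normal-form Q
... | n , cn , P≈n | m , cm , Q≈m =
  trans≈ P≈n (trans≈ (≡⇒≈ (treeᴺ-injective n m cn cm treeᴺn≡treeᴺm)) (sym≈ Q≈m))
  where
  open ≡-Reasoning
  treeᴺn≡treeᴺm : treeᴺ n ≡ treeᴺ m
  treeᴺn≡treeᴺm = begin
    treeᴺ n     ≡⟨ se-⌜⌝ n ⟨
    se ⌜ n ⌝    ≡⟨ se-sound P≈n ⟨
    se P        ≡⟨ e ⟩
    se Q        ≡⟨ se-sound Q≈m ⟩
    se ⌜ m ⌝    ≡⟨ se-⌜⌝ m ⟩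
    treeᴺ m     ∎

⊢≈⇔se≡ : ∀ {P Q : S A} → A ⊢ P ≈ Q ⇔ se P ≡ se Q
⊢≈⇔se≡ {P = P} {Q} = mk⇔ se-sound (se-complete P Q)

-- The atoms are never inspected, so the set A need not be inhabited.
theorem2p5 : (A : Set) → A → (P Q : S A) →
    (EqFSCL⊢ A P Q ⇔ (⟦ P ⟧se ≡ ⟦ Q ⟧se)) × (EqFSCL⊢ A P Q ⇔ (se P ≡ se Q))
theorem2p5 A _ P Q rewrite ⟦⟧se≡se P | ⟦⟧se≡se Q = ⊢≈⇔se≡ , ⊢≈⇔se≡
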